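{- Work in $PG(5,2)$ with coordinates $(X_1,\dots,X_6)$, let $N$ be the plane $X_1=X_2=X_3=0$, and let $Q^+(5,2)$ be the hyperbolic quadric $X_1X_6+X_2X_5+X_3X_4=0$ (which contains $N$). Let $\mathcal{M}^3_4$ be the set of points $(X_1,\dots,X_6)$ for which $\det\begin{pmatrix} X_1 & X_4 & X_5\\ X_4 & X_2 & X_6\\ X_5 & X_6 & X_3\end{pmatrix}=0$ over $GF(2)$ (this set also contains $N$). Define the graph $\widehat{N\mathcal{M}^3_4}$ with vertex set $PG(5,2)\setminus\mathcal{M}^3_4$, and the graph $\widehat{NO^+(6,2)}$ with vertex set $PG(5,2)\setminus Q^+(5,2)$; in both graphs two distinct vertices $u,v$ are adjacent if and only if the third point $u+v$ of the line $\langle u,v\rangle$ lies in $N$. Then $\widehat{N\mathcal{M}^3_4}\cong\widehat{NO^+(6,2)}$, and each of these graphs is the disjoint union of $7$ copies of the complete graph $K_4$.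
   Context: Over $GF(2)$ a line of $PG(5,2)$ through distinct points $u,v$ consists of exactly the three points $u$, $v$, $u+v$. -}

module Defs where

open import Data.Bool using (Bool; true; false; _xor_; _∧_)
open import Data.Vec using (Vec; []; _∷_; replicate; zipWith)
open import Data.Fin using (Fin)
open import Data.Product using (Σ; _×_; proj₁; proj₂)
open import Relation.Binary.PropositionalEquality using (_≡_)
open import Relation.Nullary using (¬_)
open import Function.Bundles using (_⤖_; _⇔_; Bijection)

-- GF(2) is Bool with _xor_ as addition and _∧_ as multiplication.
-- Vectors of GF(2)^6, coordinates (X1,...,X6).
V6 : Set
V6 = Vec Bool 6

zero6 : V6
zero6 = replicate 6 false

-- Points of PG(5,2): nonzero vectors (over GF(2) each point has a unique
-- nonzero representative).
IsPoint : V6 → Set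
IsPoint v = ¬ (v ≡ zero6)

_⊕_ : V6 → V6 → V6
_⊕_ = zipWith _xor_

InN : V6 → Set
InN (x1 ∷ x2 ∷ x3 ∷ x4 ∷ x5 ∷ x6 ∷ []) =
  (x1 ≡ false) × (x2 ≡ false) × (x3 ≡ false) × ¬ ((x4 ∷ x5 ∷ x6 ∷ []) ≡ replicate 3 false)

qform : V6 → Bool
qform (x1 ∷ x2 ∷ x3 ∷ x4 ∷ x5 ∷ x6 ∷ []) = (x1 ∧ x6) xor ((x2 ∧ x5) xor (x3 ∧ x4))

InQ : V6 → Set
InQ v = qform v ≡ false

-- determinant of a 3x3 matrix over GF(2) (cofactor expansion along the first row;
-- signs are irrelevant in characteristic 2)
det3 : Bool → Bool → Bool → Bool → Bool → Bool → Bool → Bool → Bool → Bool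
det3 a11 a12 a13 a21 a22 a23 a31 a32 a33 =
  (a11 ∧ ((a22 ∧ a33) xor (a23 ∧ a32))) xor
  ((a12 ∧ ((a21 ∧ a33) xor (a23 ∧ a31))) xor
   (a13 ∧ ((a21 ∧ a32) xor (a22 ∧ a31))))

detM : V6 → Bool
detM (x1 ∷ x2 ∷ x3 ∷ x4 ∷ x5 ∷ x6 ∷ []) =
  det3 x1 x4 x5
       x4 x2 x6
       x5 x6 x3

InM : V6 → Set
InM v = detM v ≡ false

VertM : Set
VertM = Σ V6 (λ v → IsPoint v × ¬ InM v)

VertO : Set
VertO = Σ V6 (λ v → IsPoint v × ¬ InQ v)

AdjPt : V6 → V6 → Set
AdjPt u v = ¬ (u ≡ v) × InN (u ⊕ v)

AdjM : VertM → VertM → Set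
AdjM x y = AdjPt (proj₁ x) (proj₁ y)

AdjO : VertO → VertO → Set
AdjO x y = AdjPt (proj₁ x) (proj₁ y)

GraphIso : (A B : Set) → (A → A → Set) → (B → B → Set) → Set
GraphIso A B R S = Σ (A ⤖ B) (λ f → ∀ x y → R x y ⇔ S (Bijection.to f x) (Bijection.to f y))

AdjUnionK : (m k : _) → Fin m × Fin k → Fin m × Fin k → Set
AdjUnionK m k p q = (proj₁ p ≡ proj₁ q) × ¬ (proj₂ p ≡ proj₂ q)

IsUnionOfK : (m k : _) (A : Set) → (A → A → Set) → Set
IsUnionOfK m k A R = GraphIso A (Fin m × Fin k) R (AdjUnionK m k)

{-# OPTIONS --safe #-}
module Submission where

-- Two points are adjacent iff u + v lies in N, i.e. iff they are distinct with the same first three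
-- coordinates; so both graphs are unions of cliques, one on each fibre over the 7 nonzero vectors
-- a ∈ GF(2)³. Over GF(2) we have x² = x and 2 = 0, so det = X₁X₆ + X₂X₅ + X₃X₄ + X₁X₂X₃: the shear
-- X₆ ↦ X₆ + X₁X₂X₃, which fixes the first three coordinates, carries the complement of M³₄ onto the
-- complement of Q⁺(5,2) and is a graph isomorphism. Off Q⁺(5,2) the fibre over a is the set of
-- solutions of the nonzero linear equation a₁X₆ + a₂X₅ + a₃X₄ = 1, an affine plane of 4 points.

open import Defs
open import Data.Bool using (Bool; true; false; not; _xor_; _∧_)
open import Data.Bool.Properties using (xor-same; xor-assoc; xor-identityʳ) renaming (_≟_ to _≟ᵇ_)
open import Data.Fin using (Fin; zero; suc)
open import Data.Fin.Properties using (all?; any?) renaming (_≟_ to _≟ᶠ_)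
open import Data.Nat using (ℕ)
open import Data.Product using (∃₂; _×_; _,_; proj₁; proj₂; Σ)
open import Data.Vec using (Vec; []; _∷_; _++_; replicate; zipWith)
open import Data.Vec.Properties using (∷-injective) renaming (≡-dec to ≡-decᵛ)
open import Function using (_∘_)
open import Function.Bundles using (_⇔_; mk⇔; mk↔ₛ′; Bijection; Equivalence)
open import Function.Construct.Composition using (_⤖-∘_; _⇔-∘_)
open import Function.Properties.Equivalence using () renaming (sym to ⇔-sym)
open import Function.Properties.Inverse using (↔⇒⤖)
open import Relation.Binary.Definitions using (DecidableEquality)
open import Relation.Binary.PropositionalEquality
open import Relation.Nullary using (¬_; Dec)
open import Relation.Nullary.Decidable using (map′; from-yes; ¬?; _×-dec_; _→-dec_)
open import Relation.Unary using (Decidable)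

∀-Vec-Bool? : ∀ {n} {P : Vec Bool n → Set} → Decidable P → Dec (∀ v → P v)
∀-Vec-Bool? {ℕ.zero} P? = map′ (λ p → λ { [] → p }) (λ p → p []) (P? [])
∀-Vec-Bool? {ℕ.suc n} P? =
  map′ (λ (p₀ , p₁) → λ { (false ∷ v) → p₀ v ; (true ∷ v) → p₁ v })
       (λ p → p ∘ (false ∷_) , p ∘ (true ∷_))
       (∀-Vec-Bool? (P? ∘ (false ∷_)) ×-dec ∀-Vec-Bool? (P? ∘ (true ∷_)))

_≟ᵛ_ : ∀ {n} → DecidableEquality (Vec Bool n)
_≟ᵛ_ = ≡-decᵛ _≟ᵇ_

xor≡false⇒≡ : ∀ {x y} → x xor y ≡ false → x ≡ y
xor≡false⇒≡ {false} {false} _ = refl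
xor≡false⇒≡ {true}  {true}  _ = refl

zipWith-xor≡replicate⇒≡ : ∀ {n} (x y : Vec Bool n) → zipWith _xor_ x y ≡ replicate n false → x ≡ y
zipWith-xor≡replicate⇒≡ []      []      _ = refl
zipWith-xor≡replicate⇒≡ (a ∷ x) (b ∷ y) e =
  cong₂ _∷_ (xor≡false⇒≡ (proj₁ (∷-injective e))) (zipWith-xor≡replicate⇒≡ x y (proj₂ (∷-injective e)))

take3 : V6 → Vec Bool 3
take3 (x₁ ∷ x₂ ∷ x₃ ∷ _) = x₁ ∷ x₂ ∷ x₃ ∷ []

take3-++ : (a b : Vec Bool 3) → take3 (a ++ b) ≡ a
take3-++ (a₁ ∷ a₂ ∷ a₃ ∷ []) b = refl

AdjPt⇔ : ∀ u v → AdjPt u v ⇔ (¬ u ≡ v × take3 u ≡ take3 v)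
AdjPt⇔ (u₁ ∷ u₂ ∷ u₃ ∷ u₄ ∷ u₅ ∷ u₆ ∷ []) (v₁ ∷ v₂ ∷ v₃ ∷ v₄ ∷ v₅ ∷ v₆ ∷ []) = mk⇔
  (λ (u≢v , e₁ , e₂ , e₃ , _) → u≢v ,
     zipWith-xor≡replicate⇒≡ (u₁ ∷ u₂ ∷ u₃ ∷ []) (v₁ ∷ v₂ ∷ v₃ ∷ []) (cong₂ _∷_ e₁ (cong₂ _∷_ e₂ (cong (_∷ []) e₃))))
  (λ { (u≢v , refl) → u≢v , xor-same u₁ , xor-same u₂ , xor-same u₃ ,
     λ e → u≢v (cong ((u₁ ∷_) ∘ (u₂ ∷_) ∘ (u₃ ∷_))
                    (zipWith-xor≡replicate⇒≡ (u₄ ∷ u₅ ∷ u₆ ∷ []) (v₄ ∷ v₅ ∷ v₆ ∷ []) e)) })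

Vertices : (V6 → Set) → Set
Vertices B = Σ V6 (λ v → IsPoint v × ¬ B v)

Adjacent : (B : V6 → Set) → Vertices B → Vertices B → Set
Adjacent B x y = AdjPt (proj₁ x) (proj₁ y)

-- Proofs of a negation are definitionally equal (⊥ is proof-irrelevant), so a vertex is its point.
Vertices-≡ : ∀ {B} {x y : Vertices B} → proj₁ x ≡ proj₁ y → x ≡ y
Vertices-≡ refl = refl

graphIso-∘ : ∀ {A B C : Set} {R S T} → GraphIso A B R S → GraphIso B C S T → GraphIso A C R T
graphIso-∘ (f , f-adj) (g , g-adj) =
  g ⤖-∘ f , λ x y → g-adj (Bijection.to f x) (Bijection.to f y) ⇔-∘ f-adj x y

module _ {B B′ : V6 → Set} (σ : V6 → V6) (σ-involutive : ∀ v → σ (σ v) ≡ v)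
         (σ-zero : σ zero6 ≡ zero6) (take3-σ : ∀ v → take3 (σ v) ≡ take3 v)
         (B⇔B′∘σ : ∀ v → B v ⇔ B′ (σ v)) where

  private
    σ-injective : ∀ {u v} → σ u ≡ σ v → u ≡ v
    σ-injective {u} {v} e = trans (sym (σ-involutive u)) (trans (cong σ e) (σ-involutive v))

    σ-point : ∀ {v} → IsPoint v → IsPoint (σ v)
    σ-point v≢0 e = v≢0 (σ-injective (trans e (sym σ-zero)))

    σ-AdjPt : ∀ u v → AdjPt u v ⇔ AdjPt (σ u) (σ v)
    σ-AdjPt u v = ⇔-sym (AdjPt⇔ (σ u) (σ v)) ⇔-∘ (mk⇔
      (λ (u≢v , e) → (u≢v ∘ σ-injective) , trans (take3-σ u) (trans e (sym (take3-σ v))))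
      (λ (σu≢σv , e) → (σu≢σv ∘ cong σ) , trans (sym (take3-σ u)) (trans e (take3-σ v)))
      ⇔-∘ AdjPt⇔ u v)

    to : Vertices B → Vertices B′
    to (v , v≢0 , v∉B) = σ v , σ-point v≢0 , v∉B ∘ Equivalence.from (B⇔B′∘σ v)

    from : Vertices B′ → Vertices B
    from (w , w≢0 , w∉B′) = σ w , σ-point w≢0 ,
      λ σw∈B → w∉B′ (subst B′ (σ-involutive w) (Equivalence.to (B⇔B′∘σ (σ w)) σw∈B))

  graphIso-by-involution : GraphIso (Vertices B) (Vertices B′) (Adjacent B) (Adjacent B′)
  graphIso-by-involution =
    ↔⇒⤖ (mk↔ₛ′ to from (Vertices-≡ ∘ σ-involutive ∘ proj₁) (Vertices-≡ ∘ σ-involutive ∘ proj₁)) ,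
    λ x y → σ-AdjPt (proj₁ x) (proj₁ y)

record FibreEnumeration (B : V6 → Set) (m k : ℕ) : Set where
  field
    label            : Fin m → Vec Bool 3
    label-injective  : ∀ i i′ → label i ≡ label i′ → i ≡ i′
    point            : Fin m → Fin k → V6
    take3-point      : ∀ i j → take3 (point i j) ≡ label i
    point-injective  : ∀ i j i′ j′ → point i j ≡ point i′ j′ → i ≡ i′ × j ≡ j′
    point-vertex     : ∀ i j → IsPoint (point i j) × ¬ B (point i j)
    point-surjective : ∀ v → IsPoint v → ¬ B v → ∃₂ λ i j → point i j ≡ v

module _ {B : V6 → Set} {m k : ℕ} (E : FibreEnumeration B m k) where

  open FibreEnumeration E

  private
    index : Vertices B → Fin m × Fin k
    index (v , v≢0 , v∉B) = let (i , j , _) = point-surjective v v≢0 v∉B in i , j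

    vertex : Fin m × Fin k → Vertices B
    vertex (i , j) = point i j , point-vertex i j

    index-vertex : ∀ p → index (vertex p) ≡ p
    index-vertex (i , j) with point-surjective (point i j) (proj₁ (point-vertex i j)) (proj₂ (point-vertex i j))
    ... | i′ , j′ , e = let (i′≡i , j′≡j) = point-injective i′ j′ i j e in cong₂ _,_ i′≡i j′≡j

    vertex-index : ∀ x → vertex (index x) ≡ x
    vertex-index (v , v≢0 , v∉B) = Vertices-≡ (proj₂ (proj₂ (point-surjective v v≢0 v∉B)))

    AdjPt-point : ∀ i j i′ j′ → AdjPt (point i j) (point i′ j′) ⇔ AdjUnionK m k (i , j) (i′ , j′)
    AdjPt-point i j i′ j′ = mk⇔
      (λ (p≢p′ , e) → let i≡i′ = label-injective i i′ (trans (sym (take3-point i j)) (trans e (take3-point i′ j′)))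
                       in i≡i′ , λ j≡j′ → p≢p′ (cong₂ point i≡i′ j≡j′))
      (λ { (refl , j≢j′) → (j≢j′ ∘ proj₂ ∘ point-injective i j i j′) ,
                            trans (take3-point i j) (sym (take3-point i j′)) })
      ⇔-∘ AdjPt⇔ (point i j) (point i′ j′)

    Adjacent-index : ∀ x y → Adjacent B x y ⇔ AdjUnionK m k (index x) (index y)
    Adjacent-index (v , v≢0 , v∉B) (w , w≢0 , w∉B) =
      let (i , j , pij≡v) = point-surjective v v≢0 v∉B
          (i′ , j′ , pi′j′≡w) = point-surjective w w≢0 w∉B
      in subst₂ (λ v w → AdjPt v w ⇔ AdjUnionK m k (i , j) (i′ , j′)) pij≡v pi′j′≡w (AdjPt-point i j i′ j′)

  FibreEnumeration⇒IsUnionOfK : IsUnionOfK m k (Vertices B) (Adjacent B)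
  FibreEnumeration⇒IsUnionOfK = ↔⇒⤖ (mk↔ₛ′ index vertex index-vertex vertex-index) , Adjacent-index

shear : V6 → V6
shear (x₁ ∷ x₂ ∷ x₃ ∷ x₄ ∷ x₅ ∷ x₆ ∷ []) = x₁ ∷ x₂ ∷ x₃ ∷ x₄ ∷ x₅ ∷ (x₆ xor (x₁ ∧ (x₂ ∧ x₃))) ∷ []

shear-involutive : ∀ v → shear (shear v) ≡ v
shear-involutive (x₁ ∷ x₂ ∷ x₃ ∷ x₄ ∷ x₅ ∷ x₆ ∷ []) =
  cong (λ x → x₁ ∷ x₂ ∷ x₃ ∷ x₄ ∷ x₅ ∷ x ∷ []) (begin
    (x₆ xor c) xor c  ≡⟨ xor-assoc x₆ c c ⟩
    x₆ xor (c xor c)  ≡⟨ cong (x₆ xor_) (xor-same c) ⟩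
    x₆ xor false      ≡⟨ xor-identityʳ x₆ ⟩
    x₆                ∎)
  where
  open ≡-Reasoning
  c : Bool
  c = x₁ ∧ (x₂ ∧ x₃)

take3-shear : ∀ v → take3 (shear v) ≡ take3 v
take3-shear (x₁ ∷ x₂ ∷ x₃ ∷ _ ∷ _ ∷ _ ∷ []) = refl

detM≡qform∘shear : ∀ v → detM v ≡ qform (shear v)
detM≡qform∘shear = from-yes (∀-Vec-Bool? λ v → detM v ≟ᵇ qform (shear v))

InM⇔InQ∘shear : ∀ v → InM v ⇔ InQ (shear v)
InM⇔InQ∘shear v = mk⇔ (trans (sym (detM≡qform∘shear v))) (trans (detM≡qform∘shear v))

graphIsoMO : GraphIso VertM VertO AdjM AdjO
graphIsoMO = graphIso-by-involution shear shear-involutive refl take3-shear InM⇔InQ∘shear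

fanoPoint : Fin 7 → Vec Bool 3
fanoPoint zero                                     = false ∷ false ∷ true  ∷ []
fanoPoint (suc zero)                               = false ∷ true  ∷ false ∷ []
fanoPoint (suc (suc zero))                         = false ∷ true  ∷ true  ∷ []
fanoPoint (suc (suc (suc zero)))                   = true  ∷ false ∷ false ∷ []
fanoPoint (suc (suc (suc (suc zero))))             = true  ∷ false ∷ true  ∷ []
fanoPoint (suc (suc (suc (suc (suc zero)))))       = true  ∷ true  ∷ false ∷ []
fanoPoint (suc (suc (suc (suc (suc (suc zero)))))) = true  ∷ true  ∷ true  ∷ []

bits : Fin 4 → Bool × Bool
bits zero                   = false , false
bits (suc zero)             = false , true
bits (suc (suc zero))       = true  , false
bits (suc (suc (suc zero))) = true  , true

-- The point of the plane a₁X₆ + a₂X₅ + a₃X₄ = 1 with free coordinates s, t, solving for the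
-- coordinate paired with the first nonzero aᵢ (the last clause is junk when a = 0).
affinePoint : Vec Bool 3 → Bool × Bool → Vec Bool 3
affinePoint (true  ∷ a₂   ∷ a₃ ∷ []) (s , t) = s ∷ t ∷ not ((a₂ ∧ t) xor (a₃ ∧ s)) ∷ []
affinePoint (false ∷ true ∷ a₃ ∷ []) (s , t) = s ∷ not (a₃ ∧ s) ∷ t ∷ []
affinePoint (false ∷ false ∷ _ ∷ []) (s , t) = true ∷ s ∷ t ∷ []

pointQ : Fin 7 → Fin 4 → V6
pointQ i j = fanoPoint i ++ affinePoint (fanoPoint i) (bits j)

fibreEnumerationQ : FibreEnumeration InQ 7 4
fibreEnumerationQ = record
  { label            = fanoPoint
  ; label-injective  = from-yes (all? λ i → all? λ i′ → fanoPoint i ≟ᵛ fanoPoint i′ →-dec i ≟ᶠ i′)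
  ; point            = pointQ
  ; take3-point      = λ i j → take3-++ (fanoPoint i) _
  ; point-injective  = from-yes (all? λ i → all? λ j → all? λ i′ → all? λ j′ →
                         pointQ i j ≟ᵛ pointQ i′ j′ →-dec (i ≟ᶠ i′ ×-dec j ≟ᶠ j′))
  ; point-vertex     = from-yes (all? λ i → all? λ j →
                         ¬? (pointQ i j ≟ᵛ zero6) ×-dec ¬? (qform (pointQ i j) ≟ᵇ false))
  ; point-surjective = from-yes (∀-Vec-Bool? λ v →
                         ¬? (v ≟ᵛ zero6) →-dec ¬? (qform v ≟ᵇ false) →-dec
                         any? λ i → any? λ j → pointQ i j ≟ᵛ v)
  }

mainTheorem3 : GraphIso VertM VertO AdjM AdjO
               × IsUnionOfK 7 4 VertM AdjM
               × IsUnionOfK 7 4 VertO AdjO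
mainTheorem3 = graphIsoMO , graphIso-∘ {T = AdjUnionK 7 4} graphIsoMO unionO , unionO
  where
  unionO : IsUnionOfK 7 4 VertO AdjO
  unionO = FibreEnumeration⇒IsUnionOfK fibreEnumerationQ
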